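{- Let $\varphi,\psi$ be patterns and $X$ a set variable such that $X$ is free for $\psi$ in $\varphi$. Then for every structure $\mathcal A$ and every $\mathcal A$-valuation $e$: if $\bar e(\varphi[\psi/X])\subseteq\bar e(\psi)$, then $\bar e(\mu X.\varphi)\subseteq\bar e(\psi)$.
   Context: Patterns over pairwise disjoint sets $EVar$ (element variables), $SVar$ (set variables) and constants $\Sigma$: $\varphi ::= x \mid X \mid \sigma \mid \varphi\,\varphi \mid \varphi\to\varphi \mid \exists x.\varphi \mid \mu X.\varphi$ (no positivity restriction on $\mu$); $\exists x$ binds $x$, $\mu X$ binds $X$, $FV$ = free variables. $\varphi[\delta/X]$ replaces every free occurrence of $X$ in $\varphi$ by $\delta$; $X$ is free for $\delta$ in $\varphi$ if no free occurrence of $X$ in $\varphi$ lies within the scope $\theta$ of a subpattern $\exists z.\theta$ with $z\in FV(\delta)$ or $\mu Z.\theta$ with $Z\in FV(\delta)$. Structure $\mathcal A=(A,\cdot,(\sigma^{\mathcal A}))$: $A\ne\emptyset$, $\cdot:A\times A\to 2^A$, $\sigma^{\mathcal A}\subseteq A$; $B\cdot C:=\bigcup_{b\in B,c\in C}b\cdot c$. Valuations $e$; updates $e[a/x]$, $e[B/X]$. $\bar e(x)=\{e(x)\}$, $\bar e(X)=e(X)$, $\bar e(\sigma)=\sigma^{\mathcal A}$, $\bar e(\varphi\psi)=\bar e(\varphi)\cdot\bar e(\psi)$, $\bar e(\varphi\to\psi)=A\setminus(\bar e(\varphi)\setminus\bar e(\psi))$, $\bar e(\exists x.\varphi)=\bigcup_{a}\overline{e[a/x]}(\varphi)$,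 $\bar e(\mu X.\varphi)=\bigcap\{B\subseteq A:\overline{e[B/X]}(\varphi)\subseteq B\}$. (The hypothesis $\bar e(\varphi[\psi/X])\subseteq\bar e(\psi)$ is equivalent to $\bar e(\varphi[\psi/X]\to\psi)=A$, and the conclusion to $\bar e(\mu X.\varphi\to\psi)=A$.) -}

module Defs where

open import Level using (Level; 0ℓ; Lift) renaming (suc to lsuc)
open import Data.Nat using (ℕ; _≟_)
open import Data.Product using (Σ; ∃; _×_; _,_)
open import Data.Unit using (⊤)
open import Relation.Nullary using (¬_; yes; no)
open import Relation.Binary.PropositionalEquality using (_≡_)
open import Relation.Unary using (Pred; _⊆_)

-- Element variables and set variables are both indexed by ℕ (two disjoint
-- countably infinite sorts, kept apart by the constructors below);
-- constants range over an arbitrary type Sig.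
EVar : Set
EVar = ℕ

SVar : Set
SVar = ℕ

data Pattern (Sig : Set) : Set where
  evar  : EVar → Pattern Sig
  svar  : SVar → Pattern Sig
  const : Sig → Pattern Sig
  app   : Pattern Sig → Pattern Sig → Pattern Sig
  imp   : Pattern Sig → Pattern Sig → Pattern Sig
  ex    : EVar → Pattern Sig → Pattern Sig
  mu    : SVar → Pattern Sig → Pattern Sig

module _ {Sig : Set} where

  EFree : EVar → Pattern Sig → Set
  EFree x (evar y) = x ≡ y
  EFree x (svar _) = Data.Empty.⊥
    where import Data.Empty
  EFree x (const _) = Data.Empty.⊥
    where import Data.Empty
  EFree x (app φ ψ) = EFree x φ Data.Sum.⊎ EFree x ψ
    where import Data.Sum
  EFree x (imp φ ψ) = EFree x φ Data.Sum.⊎ EFree x ψ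
    where import Data.Sum
  EFree x (ex y φ) = ¬ (x ≡ y) × EFree x φ
  EFree x (mu _ φ) = EFree x φ

  SFree : SVar → Pattern Sig → Set
  SFree X (evar _) = Data.Empty.⊥
    where import Data.Empty
  SFree X (svar Y) = X ≡ Y
  SFree X (const _) = Data.Empty.⊥
    where import Data.Empty
  SFree X (app φ ψ) = SFree X φ Data.Sum.⊎ SFree X ψ
    where import Data.Sum
  SFree X (imp φ ψ) = SFree X φ Data.Sum.⊎ SFree X ψ
    where import Data.Sum
  SFree X (ex _ φ) = SFree X φ
  SFree X (mu Y φ) = ¬ (X ≡ Y) × SFree X φ

  -- φ[δ/X]: replace every free occurrence of X in φ by δ (no renaming)
  _[_/_] : Pattern Sig → Pattern Sig → SVar → Pattern Sig
  evar x [ δ / X ] = evar x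
  svar Y [ δ / X ] with X ≟ Y
  ... | yes _ = δ
  ... | no _ = svar Y
  const σ [ δ / X ] = const σ
  app φ ψ [ δ / X ] = app (φ [ δ / X ]) (ψ [ δ / X ])
  imp φ ψ [ δ / X ] = imp (φ [ δ / X ]) (ψ [ δ / X ])
  ex x φ [ δ / X ] = ex x (φ [ δ / X ])
  mu Y φ [ δ / X ] with X ≟ Y
  ... | yes _ = mu Y φ
  ... | no _ = mu Y (φ [ δ / X ])

  FreeFor : SVar → Pattern Sig → Pattern Sig → Set
  FreeFor X δ (evar _) = ⊤
  FreeFor X δ (svar _) = ⊤
  FreeFor X δ (const _) = ⊤
  FreeFor X δ (app φ ψ) = FreeFor X δ φ × FreeFor X δ ψ
  FreeFor X δ (imp φ ψ) = FreeFor X δ φ × FreeFor X δ ψ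
  FreeFor X δ (ex z θ) = (SFree X θ → ¬ EFree z δ) × FreeFor X δ θ
  FreeFor X δ (mu Z θ) with X ≟ Z
  ... | yes _ = ⊤   -- X is bound here: no free occurrence of X below
  ... | no _ = (SFree X θ → ¬ SFree Z δ) × FreeFor X δ θ

record Structure (Sig : Set) : Set₁ where
  field
    Carrier : Set
    inhabitant : Carrier
    _·_ : Carrier → Carrier → Pred Carrier 0ℓ
    interp : Sig → Pred Carrier 0ℓ

module _ {Sig : Set} (𝒜 : Structure Sig) where
  open Structure 𝒜

  record Valuation : Set₁ where
    field
      ev : EVar → Carrier
      sv : SVar → Pred Carrier 0ℓ
  open Valuation public

  updE : Valuation → EVar → Carrier → Valuation
  ev (updE e x a) y with x ≟ y
  ... | yes _ = a
  ... | no _ = ev e y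
  sv (updE e x a) = sv e

  updS : Valuation → SVar → Pred Carrier 0ℓ → Valuation
  ev (updS e X B) = ev e
  sv (updS e X B) Y with X ≟ Y
  ... | yes _ = B
  ... | no _ = sv e Y

  _≐_ : Pred Carrier 0ℓ → Pred Carrier 0ℓ → Set
  S ≐ T = S ⊆ T × T ⊆ S

  _⋆_ : Pred Carrier 0ℓ → Pred Carrier 0ℓ → Pred Carrier 0ℓ
  (B ⋆ C) a = ∃ λ b → ∃ λ c → B b × C c × (b · c) a

  -- Den e φ S : "S is the extension ē(φ)", defined by recursion on φ
  -- following the clauses of ē (graph of the semantic function; needed
  -- because the μ-clause intersects over all subsets).
  Den : Valuation → Pattern Sig → Pred Carrier 0ℓ → Set₁
  Den e (evar x) S = Lift (lsuc 0ℓ) (S ≐ (λ a → a ≡ ev e x))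
  Den e (svar X) S = Lift (lsuc 0ℓ) (S ≐ sv e X)
  Den e (const σ) S = Lift (lsuc 0ℓ) (S ≐ interp σ)
  Den e (app φ ψ) S = Σ (Pred Carrier 0ℓ) λ S₁ → Σ (Pred Carrier 0ℓ) λ S₂ →
    Den e φ S₁ × Den e ψ S₂ × Lift (lsuc 0ℓ) (S ≐ (S₁ ⋆ S₂))
  Den e (imp φ ψ) S = Σ (Pred Carrier 0ℓ) λ S₁ → Σ (Pred Carrier 0ℓ) λ S₂ →
    Den e φ S₁ × Den e ψ S₂ × Lift (lsuc 0ℓ) (S ≐ (λ a → ¬ (S₁ a × ¬ S₂ a)))
  Den e (ex x φ) S = Σ (Carrier → Pred Carrier 0ℓ) λ F →
    (∀ b → Den (updE e x b) φ (F b)) × Lift (lsuc 0ℓ) (S ≐ (λ a → ∃ λ b → F b a))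
  Den e (mu X φ) S =
    (∀ a → S a → ∀ (B : Pred Carrier 0ℓ) →
       (∀ T → Den (updS e X B) φ T → T ⊆ B) → B a)
    × (∀ a → (∀ (B : Pred Carrier 0ℓ) →
       (∀ T → Den (updS e X B) φ T → T ⊆ B) → B a) → S a)

{-# OPTIONS --safe #-}
-- ē(μX.φ) is the least pre-fixpoint of B ↦ e[B/X](φ), so it suffices to show
-- that ē(ψ) is one. By the substitution lemma e[ē(ψ)/X](φ) = ē(φ[ψ/X]), which is
-- contained in ē(ψ) by hypothesis. The substitution lemma is proved by induction
-- on φ for valuations e, e′ that agree on the free variables of φ other than X,
-- where e interprets X as the extension of ψ under e′. Because X is free for ψ
-- in φ, no binder crossed on the way to an occurrence of X captures a free
-- variable of ψ, so ψ keeps its extension under the updated e′.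
module Submission where

open import Defs hiding (_≐_)
open import Level using (0ℓ; Lift; lift)
open import Data.Nat using (_≟_)
open import Data.Product using (∃; _×_; _,_; proj₁; proj₂; map₂)
open import Data.Sum using (inj₁; inj₂)
open import Data.Empty using (⊥-elim)
open import Function using (id; _∘_; _⇔_; mk⇔; Equivalence)
open import Function.Construct.Identity using (⇔-id)
open import Function.Construct.Symmetry using (⇔-sym)
open import Relation.Nullary using (¬_; yes; no)
open import Relation.Binary.PropositionalEquality using (_≡_; refl; sym; trans)
open import Relation.Unary using (Pred; _⊆_; _≐_)
open import Relation.Unary.Properties using (≐-refl; ≐-sym; ≐-trans)

open Equivalence using (to; from)

module _ {Sig : Set} (𝒜 : Structure Sig) where
  open Structure 𝒜

  private
    Subset : Set₁
    Subset = Pred Carrier 0ℓ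

    variable
      P P′ : Pred EVar 0ℓ
      Q Q′ : Pred SVar 0ℓ
      e e′ : Valuation 𝒜
      φ φ′ ψ ψ′ : Pattern Sig
      R R′ S S′ S₁ S₂ T₁ T₂ B : Subset
      F G : Carrier → Subset
      x z : EVar
      X Z : SVar
      b : Carrier

  ≡⇒≐ : S ≡ S′ → S ≐ S′
  ≡⇒≐ refl = ≐-refl

  ⋆-cong : S₁ ≐ T₁ → S₂ ≐ T₂ → _⋆_ 𝒜 S₁ S₂ ≐ _⋆_ 𝒜 T₁ T₂
  ⋆-cong (S₁⊆T₁ , T₁⊆S₁) (S₂⊆T₂ , T₂⊆S₂) =
    (λ (b , c , b∈ , c∈ , a∈bc) → b , c , S₁⊆T₁ b∈ , S₂⊆T₂ c∈ , a∈bc) ,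
    (λ (b , c , b∈ , c∈ , a∈bc) → b , c , T₁⊆S₁ b∈ , T₂⊆S₂ c∈ , a∈bc)

  implication-cong : S₁ ≐ T₁ → S₂ ≐ T₂ →
    (λ a → ¬ (S₁ a × ¬ S₂ a)) ≐ (λ a → ¬ (T₁ a × ¬ T₂ a))
  implication-cong (S₁⊆T₁ , T₁⊆S₁) (S₂⊆T₂ , T₂⊆S₂) =
    (λ ¬S₁∖S₂ (t₁ , ¬t₂) → ¬S₁∖S₂ (T₁⊆S₁ t₁ , ¬t₂ ∘ S₂⊆T₂)) ,
    (λ ¬T₁∖T₂ (s₁ , ¬s₂) → ¬T₁∖T₂ (S₁⊆T₁ s₁ , ¬s₂ ∘ T₂⊆S₂))

  ⋃-cong : (∀ b → F b ≐ G b) → (λ a → ∃ λ b → F b a) ≐ (λ a → ∃ λ b → G b a)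
  ⋃-cong F≐G = (λ (b , a∈) → b , proj₁ (F≐G b) a∈) , (λ (b , a∈) → b , proj₂ (F≐G b) a∈)

  Lift-≐-congʳ : ∀ {ℓ} → R ≐ R′ → Lift ℓ (S ≐ R) ⇔ Lift ℓ (S ≐ R′)
  Lift-≐-congʳ R≐R′ =
    mk⇔ (λ (lift S≐R) → lift (≐-trans S≐R R≐R′)) (λ (lift S≐R′) → lift (≐-trans S≐R′ (≐-sym R≐R′)))

  Den-resp-≐ : ∀ φ → Den 𝒜 e φ S → S ≐ S′ → Den 𝒜 e φ S′
  Den-resp-≐ (evar _) (lift S≐) S≐S′ = lift (≐-trans (≐-sym S≐S′) S≐)
  Den-resp-≐ (svar _) (lift S≐) S≐S′ = lift (≐-trans (≐-sym S≐S′) S≐)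
  Den-resp-≐ (const _) (lift S≐) S≐S′ = lift (≐-trans (≐-sym S≐S′) S≐)
  Den-resp-≐ (app _ _) (S₁ , S₂ , D₁ , D₂ , lift S≐) S≐S′ =
    S₁ , S₂ , D₁ , D₂ , lift (≐-trans (≐-sym S≐S′) S≐)
  Den-resp-≐ (imp _ _) (S₁ , S₂ , D₁ , D₂ , lift S≐) S≐S′ =
    S₁ , S₂ , D₁ , D₂ , lift (≐-trans (≐-sym S≐S′) S≐)
  Den-resp-≐ (ex _ _) (F , D , lift S≐) S≐S′ = F , D , lift (≐-trans (≐-sym S≐S′) S≐)
  Den-resp-≐ (mu _ _) (sound , complete) (S⊆S′ , S′⊆S) =
    (λ a a∈S′ → sound a (S′⊆S a∈S′)) , (λ a a∈μ → S⊆S′ (complete a a∈μ))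

  Den-functional : ∀ φ → Den 𝒜 e φ S → Den 𝒜 e φ S′ → S ≐ S′
  Den-functional (evar _) (lift S≐) (lift S′≐) = ≐-trans S≐ (≐-sym S′≐)
  Den-functional (svar _) (lift S≐) (lift S′≐) = ≐-trans S≐ (≐-sym S′≐)
  Den-functional (const _) (lift S≐) (lift S′≐) = ≐-trans S≐ (≐-sym S′≐)
  Den-functional (app φ ψ) (_ , _ , D₁ , D₂ , lift S≐) (_ , _ , D₁′ , D₂′ , lift S′≐) =
    ≐-trans S≐ (≐-trans (⋆-cong (Den-functional φ D₁ D₁′) (Den-functional ψ D₂ D₂′)) (≐-sym S′≐))
  Den-functional (imp φ ψ) (_ , _ , D₁ , D₂ , lift S≐) (_ , _ , D₁′ , D₂′ , lift S′≐) =
    ≐-trans S≐ (≐-trans (implication-cong (Den-functional φ D₁ D₁′) (Den-functional ψ D₂ D₂′))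
                        (≐-sym S′≐))
  Den-functional (ex _ φ) (_ , D , lift S≐) (_ , D′ , lift S′≐) =
    ≐-trans S≐ (≐-trans (⋃-cong (λ b → Den-functional φ (D b) (D′ b))) (≐-sym S′≐))
  Den-functional (mu _ _) (sound , complete) (sound′ , complete′) =
    (λ a∈S → complete′ _ (sound _ a∈S)) , (λ a∈S′ → complete _ (sound′ _ a∈S′))

  Prefixpoint : Valuation 𝒜 → SVar → Pattern Sig → Subset → Set₁
  Prefixpoint e X φ B = ∀ T → Den 𝒜 (updS 𝒜 e X B) φ T → T ⊆ B

  Den-mu-least : Den 𝒜 e (mu X φ) S → Prefixpoint e X φ B → S ⊆ B
  Den-mu-least (sound , _) B-pre {a} a∈S = sound a a∈S _ B-pre

  SameDen : Valuation 𝒜 → Pattern Sig → Valuation 𝒜 → Pattern Sig → Set₁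
  SameDen e φ e′ φ′ = ∀ S → Den 𝒜 e φ S ⇔ Den 𝒜 e′ φ′ S

  Den-app-cong : SameDen e φ e′ φ′ → SameDen e ψ e′ ψ′ → SameDen e (app φ ψ) e′ (app φ′ ψ′)
  Den-app-cong φ≋ ψ≋ S = mk⇔
    (λ (S₁ , S₂ , D₁ , D₂ , S≐) → S₁ , S₂ , to (φ≋ S₁) D₁ , to (ψ≋ S₂) D₂ , S≐)
    (λ (S₁ , S₂ , D₁ , D₂ , S≐) → S₁ , S₂ , from (φ≋ S₁) D₁ , from (ψ≋ S₂) D₂ , S≐)

  Den-imp-cong : SameDen e φ e′ φ′ → SameDen e ψ e′ ψ′ → SameDen e (imp φ ψ) e′ (imp φ′ ψ′)
  Den-imp-cong φ≋ ψ≋ S = mk⇔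
    (λ (S₁ , S₂ , D₁ , D₂ , S≐) → S₁ , S₂ , to (φ≋ S₁) D₁ , to (ψ≋ S₂) D₂ , S≐)
    (λ (S₁ , S₂ , D₁ , D₂ , S≐) → S₁ , S₂ , from (φ≋ S₁) D₁ , from (ψ≋ S₂) D₂ , S≐)

  Den-ex-cong : (∀ b → SameDen (updE 𝒜 e x b) φ (updE 𝒜 e′ x b) φ′) →
    SameDen e (ex x φ) e′ (ex x φ′)
  Den-ex-cong φ≋ S = mk⇔
    (λ (F , D , S≐) → F , (λ b → to (φ≋ b (F b)) (D b)) , S≐)
    (λ (F , D , S≐) → F , (λ b → from (φ≋ b (F b)) (D b)) , S≐)

  Prefixpoint-cong : (∀ B → SameDen (updS 𝒜 e X B) φ (updS 𝒜 e′ X B) φ′) →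
    ∀ B → Prefixpoint e X φ B ⇔ Prefixpoint e′ X φ′ B
  Prefixpoint-cong φ≋ B = mk⇔
    (λ B-pre T D → B-pre T (from (φ≋ B T) D))
    (λ B-pre T D → B-pre T (to (φ≋ B T) D))

  Den-mu-cong : (∀ B → SameDen (updS 𝒜 e X B) φ (updS 𝒜 e′ X B) φ′) →
    SameDen e (mu X φ) e′ (mu X φ′)
  Den-mu-cong {e = e} {X = X} {φ = φ} {e′ = e′} {φ′ = φ′} φ≋ S =
    mk⇔ (transfer {e} {e′} {φ} {φ′} pre⇔) (transfer {e′} {e} {φ′} {φ} (⇔-sym ∘ pre⇔))
    where
      pre⇔ : ∀ B → Prefixpoint e X φ B ⇔ Prefixpoint e′ X φ′ B
      pre⇔ = Prefixpoint-cong {e = e} {X = X} {e′ = e′} φ≋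

      transfer : ∀ {e e′ φ φ′} → (∀ B → Prefixpoint e X φ B ⇔ Prefixpoint e′ X φ′ B) →
        Den 𝒜 e (mu X φ) S → Den 𝒜 e′ (mu X φ′) S
      transfer pre⇔ (sound , complete) =
        (λ a a∈S B B-pre → sound a a∈S B (from (pre⇔ B) B-pre)) ,
        (λ a a∈lfp → complete a (λ B B-pre → a∈lfp B (to (pre⇔ B) B-pre)))

  Agree : Pred EVar 0ℓ → Pred SVar 0ℓ → Valuation 𝒜 → Valuation 𝒜 → Set
  Agree P Q e e′ = (∀ {x} → P x → ev e x ≡ ev e′ x) × (∀ {X} → Q X → sv e X ≐ sv e′ X)

  AgreeOn : Pattern Sig → Valuation 𝒜 → Valuation 𝒜 → Set
  AgreeOn φ = Agree (λ x → EFree x φ) (λ X → SFree X φ)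

  Agree-mono : P′ ⊆ P → Q′ ⊆ Q → Agree P Q e e′ → Agree P′ Q′ e e′
  Agree-mono P′⊆P Q′⊆Q (agreeₑ , agreeₛ) = agreeₑ ∘ P′⊆P , agreeₛ ∘ Q′⊆Q

  updE-≢ : ¬ z ≡ x → ev (updE 𝒜 e z b) x ≡ ev e x
  updE-≢ {z = z} {x = x} z≢x with z ≟ x
  ... | yes z≡x = ⊥-elim (z≢x z≡x)
  ... | no _ = refl

  updS-≢ : ¬ Z ≡ X → sv (updS 𝒜 e Z B) X ≡ sv e X
  updS-≢ {Z = Z} {X = X} Z≢X with Z ≟ X
  ... | yes Z≡X = ⊥-elim (Z≢X Z≡X)
  ... | no _ = refl

  updS-≡ : sv (updS 𝒜 e X B) X ≡ B
  updS-≡ {X = X} with X ≟ X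
  ... | yes _ = refl
  ... | no X≢X = ⊥-elim (X≢X refl)

  Agree-updE : Agree (λ x → ¬ x ≡ z × P x) Q e e′ → Agree P Q (updE 𝒜 e z b) (updE 𝒜 e′ z b)
  Agree-updE {z = z} {P = P} {Q = Q} {e = e} {e′ = e′} {b = b} (agreeₑ , agreeₛ) = agreeₑ′ , agreeₛ
    where
      agreeₑ′ : ∀ {x} → P x → ev (updE 𝒜 e z b) x ≡ ev (updE 𝒜 e′ z b) x
      agreeₑ′ {x} x∈P with z ≟ x
      ... | yes _ = refl
      ... | no z≢x = agreeₑ ((z≢x ∘ sym) , x∈P)

  Agree-updS : Agree P (λ X → ¬ X ≡ Z × Q X) e e′ → Agree P Q (updS 𝒜 e Z B) (updS 𝒜 e′ Z B)
  Agree-updS {P = P} {Z = Z} {Q = Q} {e = e} {e′ = e′} {B = B} (agreeₑ , agreeₛ) = agreeₑ , agreeₛ′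
    where
      agreeₛ′ : ∀ {X} → Q X → sv (updS 𝒜 e Z B) X ≐ sv (updS 𝒜 e′ Z B) X
      agreeₛ′ {X} X∈Q with Z ≟ X
      ... | yes _ = ≐-refl
      ... | no Z≢X = agreeₛ ((Z≢X ∘ sym) , X∈Q)

  AgreeOn-updE-fresh : ¬ EFree z φ → AgreeOn φ e (updE 𝒜 e z b)
  AgreeOn-updE-fresh {z = z} {e = e} {b = b} z∉φ =
    (λ {x} x∈φ → sym (updE-≢ {z = z} {x = x} {e = e} {b = b} λ { refl → z∉φ x∈φ })) , λ _ → ≐-refl

  AgreeOn-updS-fresh : ¬ SFree Z φ → AgreeOn φ e (updS 𝒜 e Z B)
  AgreeOn-updS-fresh {Z = Z} {e = e} {B = B} Z∉φ =
    (λ _ → refl) ,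
    (λ {X} X∈φ → ≡⇒≐ (sym (updS-≢ {Z = Z} {X = X} {e = e} {B = B} λ { refl → Z∉φ X∈φ })))

  Den-coincidence : ∀ φ → AgreeOn φ e e′ → SameDen e φ e′ φ
  Den-coincidence (evar x) (agreeₑ , _) S =
    Lift-≐-congʳ ((λ a≡ → trans a≡ (agreeₑ refl)) , (λ a≡ → trans a≡ (sym (agreeₑ refl))))
  Den-coincidence (svar X) (_ , agreeₛ) S = Lift-≐-congʳ (agreeₛ refl)
  Den-coincidence (const σ) _ S = ⇔-id _
  Den-coincidence (app φ ψ) agree =
    Den-app-cong (Den-coincidence φ (Agree-mono inj₁ inj₁ agree))
                 (Den-coincidence ψ (Agree-mono inj₂ inj₂ agree))
  Den-coincidence (imp φ ψ) agree =
    Den-imp-cong (Den-coincidence φ (Agree-mono inj₁ inj₁ agree))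
                 (Den-coincidence ψ (Agree-mono inj₂ inj₂ agree))
  Den-coincidence {e = e} {e′ = e′} (ex z φ) agree =
    Den-ex-cong {e = e} {x = z} {e′ = e′} λ b → Den-coincidence φ (Agree-updE agree)
  Den-coincidence {e = e} {e′ = e′} (mu Z φ) agree =
    Den-mu-cong {e = e} {X = Z} {e′ = e′} λ B → Den-coincidence φ (Agree-updS agree)

  module _ (ψ : Pattern Sig) (X : SVar) {Sψ : Subset} where

    Den-subst-agree : ∀ φ → FreeFor X ψ φ →
      Agree (λ x → EFree x φ) (λ Y → ¬ Y ≡ X × SFree Y φ) e e′ →
      (SFree X φ → sv e X ≐ Sψ × Den 𝒜 e′ ψ Sψ) →
      SameDen e φ e′ (φ [ ψ / X ])
    Den-subst-agree {e = e} {e′ = e′} (evar x) _ (agreeₑ , _) _ =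
      Den-coincidence {e = e} {e′ = e′} (evar x) (agreeₑ , λ ())
    Den-subst-agree (svar Y) _ (_ , agreeₛ) target S with X ≟ Y
    ... | yes refl = let (eX≐Sψ , Dψ) = target refl in mk⇔
      (λ (lift S≐eX) → Den-resp-≐ ψ Dψ (≐-sym (≐-trans S≐eX eX≐Sψ)))
      (λ D → lift (≐-trans (Den-functional ψ D Dψ) (≐-sym eX≐Sψ)))
    ... | no X≢Y = Lift-≐-congʳ (agreeₛ (X≢Y ∘ sym , refl))
    Den-subst-agree (const σ) _ _ _ S = ⇔-id _
    Den-subst-agree (app φ θ) (ffφ , ffθ) agree target =
      Den-app-cong (Den-subst-agree φ ffφ (Agree-mono inj₁ (map₂ inj₁) agree) (target ∘ inj₁))
                   (Den-subst-agree θ ffθ (Agree-mono inj₂ (map₂ inj₂) agree) (target ∘ inj₂))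
    Den-subst-agree (imp φ θ) (ffφ , ffθ) agree target =
      Den-imp-cong (Den-subst-agree φ ffφ (Agree-mono inj₁ (map₂ inj₁) agree) (target ∘ inj₁))
                   (Den-subst-agree θ ffθ (Agree-mono inj₂ (map₂ inj₂) agree) (target ∘ inj₂))
    Den-subst-agree {e = e} {e′ = e′} (ex z θ) (z∉ψ , ffθ) agree target =
      Den-ex-cong {e = e} {x = z} {e′ = e′} λ b →
        Den-subst-agree θ ffθ (Agree-updE agree)
          (λ X∈θ → map₂ (to (Den-coincidence ψ (ψ-unchanged b (z∉ψ X∈θ)) Sψ)) (target X∈θ))
      where
        ψ-unchanged : ∀ b → ¬ EFree z ψ → AgreeOn ψ e′ (updE 𝒜 e′ z b)
        ψ-unchanged b = AgreeOn-updE-fresh {z = z} {φ = ψ} {b = b}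
    Den-subst-agree (mu Z θ) ff agree target with X ≟ Z
    ... | yes refl =
      Den-coincidence (mu X θ) (Agree-mono id (λ (Y≢X , Y∈θ) → Y≢X , Y≢X , Y∈θ) agree)
    Den-subst-agree {e = e} {e′ = e′} (mu Z θ) (Z∉ψ , ffθ) agree target | no X≢Z =
      Den-mu-cong {e = e} {X = Z} {e′ = e′} λ B →
        Den-subst-agree θ ffθ
          (Agree-updS (Agree-mono id (λ (Y≢Z , Y≢X , Y∈θ) → Y≢X , Y≢Z , Y∈θ) agree))
          (λ X∈θ → let (eX≐Sψ , Dψ) = target (X≢Z , X∈θ) in
            ≐-trans (≡⇒≐ (updS-≢ {e = e} {B = B} (X≢Z ∘ sym))) eX≐Sψ ,
            to (Den-coincidence ψ (ψ-unchanged B (Z∉ψ X∈θ)) Sψ) Dψ)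
      where
        ψ-unchanged : ∀ B → ¬ SFree Z ψ → AgreeOn ψ e′ (updS 𝒜 e′ Z B)
        ψ-unchanged B = AgreeOn-updS-fresh {Z = Z} {φ = ψ} {B = B}

    Den-subst : ∀ φ → FreeFor X ψ φ → Den 𝒜 e ψ Sψ → SameDen (updS 𝒜 e X Sψ) φ e (φ [ ψ / X ])
    Den-subst {e = e} φ ff Dψ = Den-subst-agree φ ff
      ((λ _ → refl) , (λ (Y≢X , _) → ≡⇒≐ (updS-≢ {e = e} (Y≢X ∘ sym))))
      (λ _ → ≡⇒≐ (updS-≡ {e = e} {X = X}) , Dψ)

mainTheorem12 : {Sig : Set} (φ ψ : Pattern Sig) (X : SVar) →
    FreeFor X ψ φ →
    (𝒜 : Structure Sig) (e : Valuation 𝒜) →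
    (Sφψ Sψ Sμ : Pred (Structure.Carrier 𝒜) 0ℓ) →
    Den 𝒜 e (φ [ ψ / X ]) Sφψ → Den 𝒜 e ψ Sψ → Den 𝒜 e (mu X φ) Sμ →
    Sφψ ⊆ Sψ → Sμ ⊆ Sψ
mainTheorem12 φ ψ X ff 𝒜 e Sφψ Sψ Sμ Dφψ Dψ Dμ φψ⊆ψ =
  Den-mu-least 𝒜 {e = e} {X = X} Dμ ψ-prefixpoint
  where
    ψ-prefixpoint : Prefixpoint 𝒜 e X φ Sψ
    ψ-prefixpoint T D =
      φψ⊆ψ ∘ proj₁ (Den-functional 𝒜 (φ [ ψ / X ]) (to (Den-subst 𝒜 ψ X φ ff Dψ T) D) Dφψ)
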